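{- Let $d\ge 3$ and $d'<d$. Let $Q'$ be a subgraph of the hypercube $Q_d$ isomorphic to $Q_{d'}$, with vertex set $S\subseteq\{0,1\}^d$. Then the subgraph of $\mathit{CCC}_d$ induced by $\{[\ell,x] : \ell\in\{0,\dots,d-1\},\ x\in S\}$ is convex in $\mathit{CCC}_d$.
   Context: The hypercube $Q_d$ has vertex set $\{0,1\}^d$, two binary strings being adjacent if and only if they differ in exactly one position. For $d\ge 3$, the cube-connected cycle $\mathit{CCC}_d$ has vertex set $\{[\ell,x] : \ell\in\{0,\dots,d-1\},\ x\in\{0,1\}^d\}$, where bit positions of $x$ are numbered $0,\dots,d-1$ from the left; $[\ell,x]$ and $[\ell',x']$ are adjacent if and only if either $x=x'$ and $\ell'\equiv \ell\pm 1 \pmod d$, or $\ell=\ell'$ and $x'$ is obtained from $x$ by complementing the bit in position $\ell$. (Contracting each cycle $\{[\ell,x]:\ell\}$ to a single vertex $x$ yields $Q_d$.) A subgraph $H$ of a graph $G$ is convex if every shortest path in $G$ between two vertices of $H$ is contained in $H$. -}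

module Defs where

open import Data.Nat using (ℕ; zero; suc; _+_; _*_; _≤_)
open import Data.Bool using (Bool; not)
open import Data.Fin using (Fin; toℕ)
open import Data.Vec using (Vec; lookup; updateAt)
open import Data.Product using (_×_; _,_; ∃; ∃-syntax; Σ)
open import Data.Sum using (_⊎_)
open import Relation.Nullary using (¬_)
open import Relation.Binary.PropositionalEquality using (_≡_)
open import Function.Bundles using (_⇔_)
open import Function.Definitions using (Injective)

data Walk {V : Set} (E : V → V → Set) : V → V → Set where
  nil  : ∀ {u} → Walk E u u
  cons : ∀ {u v w} → E u v → Walk E v w → Walk E u w

len : ∀ {V} {E : V → V → Set} {u v} → Walk E u v → ℕ
len nil        = zero
len (cons _ p) = suc (len p)

data OnWalk {V : Set} {E : V → V → Set} (w : V) : ∀ {u v} → Walk E u v → Set where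
  here  : ∀ {v} {p : Walk E w v} → OnWalk w p
  there : ∀ {u x v} {e : E u x} {p : Walk E x v} → OnWalk w p → OnWalk w (cons e p)

Shortest : ∀ {V} {E : V → V → Set} {u v} → Walk E u v → Set
Shortest {E = E} {u} {v} p = ∀ (q : Walk E u v) → len p ≤ len q

-- The subgraph induced by the vertex set S is convex: every shortest path
-- between two vertices of S has all its vertices in S (its edges are then
-- automatically in the induced subgraph).
InducedConvex : ∀ {V : Set} (E : V → V → Set) (S : V → Set) → Set
InducedConvex {V} E S =
  ∀ (u v : V) → S u → S v → (p : Walk E u v) → Shortest p →
  ∀ (w : V) → OnWalk w p → S w

QVertex : ℕ → Set
QVertex d = Vec Bool d

QAdj : (d : ℕ) → QVertex d → QVertex d → Set
QAdj d x y = ∃[ i ] (¬ (lookup x i ≡ lookup y i)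
                     × (∀ j → ¬ (j ≡ i) → lookup x j ≡ lookup y j))

-- H is a subgraph of Q_d with vertex set S that is isomorphic to Q_{d'}:
-- there is an edge set E ⊆ E(Q_d) on S and a bijection f : V(Q_{d'}) → S
-- with a ~ b in Q_{d'} iff f a, f b adjacent in H = (S, E).
SubcubeIso : (d d' : ℕ) → (QVertex d → Set) → Set₁
SubcubeIso d d' S =
  Σ (QVertex d → QVertex d → Set) λ E →
  Σ (QVertex d' → QVertex d) λ f →
      (∀ x y → E x y → QAdj d x y × S x × S y)
    × (∀ a → S (f a))
    × (∀ x → S x → ∃[ a ] f a ≡ x)
    × Injective _≡_ _≡_ f
    × (∀ a b → QAdj d' a b ⇔ E (f a) (f b))

ModEq : ℕ → ℕ → ℕ → Set
ModEq d m n = ∃[ k ] (m ≡ n + k * d ⊎ n ≡ m + k * d)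

CVertex : ℕ → Set
CVertex d = Fin d × QVertex d

CAdj : (d : ℕ) → CVertex d → CVertex d → Set
CAdj d (ℓ , x) (ℓ' , x') =
    (x ≡ x' × (ModEq d (toℕ ℓ') (toℕ ℓ + 1) ⊎ ModEq d (toℕ ℓ' + 1) (toℕ ℓ)))
  ⊎ (ℓ ≡ ℓ' × x' ≡ updateAt x ℓ not)

Lift : ∀ {d} → (QVertex d → Set) → CVertex d → Set
Lift S (ℓ , x) = S x

-- A copy f : Q_{d'} → Q_d is closed under stepping towards another of its
-- vertices: if f a and f b differ at bit k, some edge at a is mapped to the
-- k-edge at f a.  By induction on the distance from a to b: take an edge a—a'
-- towards b; if its image has another direction m, the induction hypothesis
-- gives an edge a'—a'' onto the k-edge at f a', and the fourth corner a''' of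
-- the square a, a', a'' spans an edge a—a''' whose image ends at the corner
-- opposite f a of its (m,k)-square, so it is the m-edge (impossible by
-- injectivity) or the k-edge.  In CCC_d flips of distinct bits commute, so a
-- walk that has to change bit i can be shortened by dropping one of its
-- i-edges; hence a shortest path only flips bits in which its current vertex
-- differs from its endpoint, and by the closure property it stays above S.
module Submission where

open import Defs
open import Data.Nat using (ℕ; zero; suc; _+_; _≤_; _<_; s≤s)
open import Data.Nat.Properties using (≤-refl; ≤-pred; <-asym; suc-injective)
open import Data.Bool using (Bool; true; false; not; _xor_; if_then_else_)
open import Data.Bool.Properties using (not-¬; ¬-not; not-involutive)
open import Data.Fin using (Fin) renaming (zero to fzero; suc to fsuc)
open import Data.Fin.Properties using () renaming (_≟_ to _≟ᶠ_)
open import Data.Vec using (Vec; []; _∷_; lookup; updateAt)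
open import Data.Vec.Properties
  using (lookup∘updateAt; lookup∘updateAt′; updateAt-commutes; updateAt-updateAt-local;
         updateAt-id; tabulate-cong; tabulate∘lookup)
open import Data.Product using (_,_; ∃-syntax; Σ-syntax; proj₁)
open import Data.Sum using (_⊎_; inj₁; inj₂)
open import Relation.Nullary using (yes; no; contradiction)
open import Relation.Binary.PropositionalEquality
open import Function.Base using (_∘_)
open import Function.Bundles using (Equivalence)
open import Function.Definitions using (Injective)

private
  variable
    n m : ℕ

flip : Vec Bool n → Fin n → Vec Bool n
flip x i = updateAt x i not

lookup-flip : (x : Vec Bool n) (i : Fin n) → lookup (flip x i) i ≡ not (lookup x i)
lookup-flip x i = lookup∘updateAt i x

lookup-flip-≢ : (x : Vec Bool n) {i j : Fin n} → j ≢ i → lookup (flip x i) j ≡ lookup x j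
lookup-flip-≢ x {i} {j} j≢i = lookup∘updateAt′ j i j≢i x

flip-involutive : (x : Vec Bool n) (i : Fin n) → flip (flip x i) i ≡ x
flip-involutive x i =
  trans (updateAt-updateAt-local i x (not-involutive (lookup x i))) (updateAt-id i x)

lookup-≡flip-≢ : {x y : Vec Bool n} {i j : Fin n} → y ≡ flip x i → j ≢ i →
                 lookup y j ≡ lookup x j
lookup-≡flip-≢ {x = x} refl j≢i = lookup-flip-≢ x j≢i

flip-comm : (x : Vec Bool n) {i j : Fin n} → i ≢ j → flip (flip x j) i ≡ flip (flip x i) j
flip-comm x {i} {j} i≢j = updateAt-commutes i j i≢j x

≢-by-not : {a b c : Bool} → a ≡ c → b ≡ not c → a ≢ b
≢-by-not a≡c b≡¬c a≡b = not-¬ a≡c (trans a≡b b≡¬c)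

flip-injective : (x : Vec Bool n) {i j : Fin n} → flip x i ≡ flip x j → i ≡ j
flip-injective x {i} {j} eq with i ≟ᶠ j
... | yes i≡j = i≡j
... | no i≢j  = contradiction (cong (λ v → lookup v i) eq)
                              (≢-by-not (lookup-flip-≢ x i≢j) (lookup-flip x i) ∘ sym)


≢-flip-flip : (x : Vec Bool n) {i j : Fin n} → i ≢ j → x ≢ flip (flip x i) j
≢-flip-flip x {i} {j} i≢j eq =
  ≢-by-not refl (trans (lookup-flip-≢ (flip x i) i≢j) (lookup-flip x i))
             (cong (λ v → lookup v i) eq)

vec-ext : {xs ys : Vec Bool n} → (∀ i → lookup xs i ≡ lookup ys i) → xs ≡ ys
vec-ext {xs = xs} {ys} eq =
  trans (sym (tabulate∘lookup xs)) (trans (tabulate-cong eq) (tabulate∘lookup ys))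

QAdj-flip : (x : Vec Bool n) (i : Fin n) → QAdj n x (flip x i)
QAdj-flip x i = i , ≢-by-not refl (lookup-flip x i) , λ j j≢i → sym (lookup-flip-≢ x j≢i)

QAdj⇒flip : {x y : Vec Bool n} → QAdj n x y → ∃[ i ] y ≡ flip x i
QAdj⇒flip {x = x} {y} (i , yᵢ≢xᵢ , agree) = i , vec-ext lookup-y
  where
  lookup-y : ∀ j → lookup y j ≡ lookup (flip x i) j
  lookup-y j with j ≟ᶠ i
  ... | yes refl = trans (¬-not (≢-sym yᵢ≢xᵢ)) (sym (lookup-flip x i))
  ... | no j≢i   = trans (sym (agree j j≢i)) (sym (lookup-flip-≢ x j≢i))

QAdj-differs-once : (x y : Vec Bool n) {i j : Fin n} → QAdj n x y →
                    lookup x i ≢ lookup y i → lookup x j ≢ lookup y j → i ≡ j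
QAdj-differs-once x y {i} {j} (q , _ , agree) xᵢ≢yᵢ xⱼ≢yⱼ =
  trans (differs⇒≡q i xᵢ≢yᵢ) (sym (differs⇒≡q j xⱼ≢yⱼ))
  where
  differs⇒≡q : ∀ k → lookup x k ≢ lookup y k → k ≡ q
  differs⇒≡q k xₖ≢yₖ with k ≟ᶠ q
  ... | yes k≡q = k≡q
  ... | no k≢q  = contradiction (agree k k≢q) xₖ≢yₖ

QAdj-flip-square : (u : Vec Bool n) {p m k : Fin n} → k ≢ m →
                   QAdj n (flip u p) (flip (flip u m) k) → p ≡ m ⊎ p ≡ k
QAdj-flip-square u {p} {m} {k} k≢m adj with p ≟ᶠ m | p ≟ᶠ k
... | yes p≡m | _       = inj₁ p≡m
... | no _    | yes p≡k = inj₂ p≡k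
... | no p≢m  | no p≢k  =
  contradiction (QAdj-differs-once (flip u p) (flip (flip u m) k) adj differs-at-k differs-at-m) k≢m
  where
  differs-at-k : lookup (flip u p) k ≢ lookup (flip (flip u m) k) k
  differs-at-k = ≢-by-not (lookup-flip-≢ u (≢-sym p≢k))
                          (trans (lookup-flip (flip u m) k) (cong not (lookup-flip-≢ u k≢m)))
  differs-at-m : lookup (flip u p) m ≢ lookup (flip (flip u m) k) m
  differs-at-m = ≢-by-not (lookup-flip-≢ u (≢-sym p≢m))
                          (trans (lookup-flip-≢ (flip u m) (≢-sym k≢m)) (lookup-flip u m))

hamming : Vec Bool n → Vec Bool n → ℕ
hamming []       []       = 0
hamming (x ∷ xs) (y ∷ ys) = (if x xor y then 1 else 0) + hamming xs ys

hamming≡0⇒≡ : (x y : Vec Bool n) → hamming x y ≡ 0 → x ≡ y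
hamming≡0⇒≡ []           []           _ = refl
hamming≡0⇒≡ (true ∷ xs)  (true ∷ ys)  h = cong (true ∷_) (hamming≡0⇒≡ xs ys h)
hamming≡0⇒≡ (false ∷ xs) (false ∷ ys) h = cong (false ∷_) (hamming≡0⇒≡ xs ys h)

hamming-suc : (x y : Vec Bool n) → hamming x y ≡ suc m → ∃[ i ] hamming (flip x i) y ≡ m
hamming-suc []           []           ()
hamming-suc (true ∷ xs)  (true ∷ ys)  h = let i , h′ = hamming-suc xs ys h in fsuc i , h′
hamming-suc (false ∷ xs) (false ∷ ys) h = let i , h′ = hamming-suc xs ys h in fsuc i , h′
hamming-suc (true ∷ xs)  (false ∷ ys) h = fzero , suc-injective h
hamming-suc (false ∷ xs) (true ∷ ys)  h = fzero , suc-injective h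

module _ {d d′ : ℕ} (f : QVertex d′ → QVertex d)
         (f-adj : ∀ {a b} → QAdj d′ a b → QAdj d (f a) (f b))
         (f-inj : Injective _≡_ _≡_ f) where

  edge-image : ∀ a j → ∃[ m ] f (flip a j) ≡ flip (f a) m
  edge-image a j = QAdj⇒flip (f-adj (QAdj-flip a j))

  flip-preimage-square : ∀ a {j j′ m k} → m ≢ k → f (flip a j) ≡ flip (f a) m →
                         f (flip (flip a j) j′) ≡ flip (f (flip a j)) k →
                         ∃[ i ] f (flip a i) ≡ flip (f a) k
  flip-preimage-square a {j} {j′} {m} {k} m≢k fm fjj′ = from-edge-image (edge-image a j′)
    where
    corner : f (flip (flip a j) j′) ≡ flip (flip (f a) m) k
    corner = trans fjj′ (cong (λ v → flip v k) fm)
    j′≢j : j′ ≢ j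
    j′≢j refl = ≢-flip-flip (f a) m≢k (trans (cong f (sym (flip-involutive a j))) corner)
    adj : ∀ {p} → f (flip a j′) ≡ flip (f a) p → QAdj d (flip (f a) p) (flip (flip (f a) m) k)
    adj fp = subst₂ (QAdj d) fp (trans (cong f (sym (flip-comm a j′≢j))) corner)
                    (f-adj (QAdj-flip (flip a j′) j))
    from-edge-image : ∃[ p ] f (flip a j′) ≡ flip (f a) p → ∃[ i ] f (flip a i) ≡ flip (f a) k
    from-edge-image (p , fp) with QAdj-flip-square (f a) (≢-sym m≢k) (adj fp)
    ... | inj₁ refl = contradiction (flip-injective a (f-inj (trans fp (sym fm)))) j′≢j
    ... | inj₂ refl = j′ , fp

  flip-preimage-at : ∀ h a b k → hamming a b ≡ h → lookup (f a) k ≢ lookup (f b) k →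
                     ∃[ i ] f (flip a i) ≡ flip (f a) k
  flip-preimage-at zero a b k dist differ =
    contradiction (cong (λ v → lookup (f v) k) (hamming≡0⇒≡ a b dist)) differ
  flip-preimage-at (suc h) a b k dist differ with hamming-suc a b dist
  ... | j , dist′ with edge-image a j
  ... | m , fm with m ≟ᶠ k
  ... | yes refl = j , fm
  ... | no m≢k with flip-preimage-at h (flip a j) b k dist′
                      (differ ∘ trans (sym (lookup-≡flip-≢ fm (≢-sym m≢k))))
  ... | j′ , fj′ = flip-preimage-square a m≢k fm fj′

  flip-preimage : ∀ a b k → lookup (f a) k ≢ lookup (f b) k → ∃[ i ] f (flip a i) ≡ flip (f a) k
  flip-preimage a b k = flip-preimage-at _ a b k refl

FlipClosed : ∀ {d} → (QVertex d → Set) → Set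
FlipClosed {d} S = ∀ x y (k : Fin d) → S x → S y → lookup x k ≢ lookup y k → S (flip x k)

subcube-flipClosed : ∀ {d d′} {S : QVertex d → Set} → SubcubeIso d d′ S → FlipClosed S
subcube-flipClosed {d} {d′} {S} (_ , f , E⊆Q , f∈S , S⊆f , f-inj , f-hom) x y k x∈S y∈S differ =
  from-preimages (S⊆f x x∈S) (S⊆f y y∈S)
  where
  f-adj : ∀ {a b} → QAdj d′ a b → QAdj d (f a) (f b)
  f-adj {a} {b} adj = proj₁ (E⊆Q (f a) (f b) (Equivalence.to (f-hom a b) adj))
  from-preimages : ∃[ a ] f a ≡ x → ∃[ b ] f b ≡ y → S (flip x k)
  from-preimages (a , refl) (b , refl) =
    let j , fj = flip-preimage f f-adj f-inj a b k differ in subst S fj (f∈S (flip a j))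

shortest-tail : ∀ {V} {E : V → V → Set} {u v w} (e : E u v) {p : Walk E v w} →
                Shortest (cons e p) → Shortest p
shortest-tail e sh q = ≤-pred (sh (cons e q))

module _ {d : ℕ} where

  shortcut : ∀ (i : Fin d) {ℓ ℓ′ x y} (p : Walk (CAdj d) (ℓ , x) (ℓ′ , y)) →
             lookup x i ≢ lookup y i →
             Σ[ q ∈ Walk (CAdj d) (ℓ , flip x i) (ℓ′ , y) ] len q < len p
  shortcut i nil differ = contradiction refl differ
  shortcut i (cons (inj₁ (refl , step)) p) differ =
    let q , q<p = shortcut i p differ in cons (inj₁ (refl , step)) q , s≤s q<p
  shortcut i {ℓ} {x = x} (cons (inj₂ (refl , refl)) p) differ with ℓ ≟ᶠ i
  ... | yes refl = p , ≤-refl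
  ... | no ℓ≢i   =
    let q , q<p = shortcut i p (differ ∘ trans (sym (lookup-flip-≢ x (≢-sym ℓ≢i))))
    in cons (inj₂ (refl , flip-comm x (≢-sym ℓ≢i))) q , s≤s q<p

  shortest-flips-towards : ∀ {ℓ ℓ′ x y} (e : CAdj d (ℓ , x) (ℓ , flip x ℓ))
                           (p : Walk (CAdj d) (ℓ , flip x ℓ) (ℓ′ , y)) →
                           Shortest (cons e p) → lookup x ℓ ≢ lookup y ℓ
  shortest-flips-towards {ℓ} {ℓ′} {x} {y} _ p sh xₗ≡yₗ =
    let q , q<p = subst (λ z → Σ[ q ∈ Walk (CAdj d) (ℓ , z) (ℓ′ , y) ] len q < len p)
                        (flip-involutive x ℓ)
                        (shortcut ℓ p (≢-sym (≢-by-not (sym xₗ≡yₗ) (lookup-flip x ℓ))))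
    in <-asym (sh q) q<p

  flipClosed⇒convex : ∀ {S : QVertex d → Set} → FlipClosed S → InducedConvex (CAdj d) (Lift S)
  flipClosed⇒convex {S} closed _ (ℓ′ , y) u∈S y∈S p sh w w∈p = stays p sh u∈S w∈p
    where
    stays : ∀ {u} (p : Walk (CAdj d) u (ℓ′ , y)) → Shortest p → Lift S u → OnWalk w p → Lift S w
    stays _ _ x∈S here = x∈S
    stays (cons e@(inj₁ (refl , _)) p) sh x∈S (there w∈p) = stays p (shortest-tail e sh) x∈S w∈p
    stays {ℓ , x} (cons e@(inj₂ (refl , refl)) p) sh x∈S (there w∈p) =
      stays p (shortest-tail e sh) (closed x y ℓ x∈S y∈S (shortest-flips-towards e p sh)) w∈p

lemma3 : (d d' : ℕ) → 3 ≤ d → d' < d →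
    (S : QVertex d → Set) → SubcubeIso d d' S →
    InducedConvex (CAdj d) (Lift S)
lemma3 d d' _ _ S iso = flipClosed⇒convex (subcube-flipClosed iso)
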